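{- Let $\alpha,\beta$ be 0-1 vectors of length $p$, and let $\mathbf x,\mathbf y$ be the row and column sum vectors given by $x_i=i-\alpha_i$ and $y_i=i-\beta_i$ for $i=1,\dots,p$. Then: (a) $\mathbf x,\mathbf y$ are consistent if and only if $\sum_i\overleftarrow{\alpha}_i=\sum_i\beta_i$ and $\overleftarrow{\alpha}\succeq\beta$. (b) Suppose $\mathbf x,\mathbf y$ are consistent. Then $\overleftarrow{\alpha}=\beta$ if and only if $\mathbf x,\mathbf y$ have a unique realization and this realization is $PM_{\bar\alpha}$.
   Context: A realization of row sums $\mathbf x$ and column sums $\mathbf y$ (both of length $p$) is a $p\times p$ 0-1 matrix with exactly $x_i$ ones in row $i$ and $y_j$ ones in column $j$; $\mathbf x,\mathbf y$ are consistent if a realization exists. For a 0-1 vector $\alpha$ of length $p$: its complement $\bar\alpha$ has $\bar\alpha_i=1-\alpha_i$; its reverse $\overleftarrow{\alpha}$ has $\overleftarrow{\alpha}_i=\alpha_{p-i+1}$. Minorization: $\alpha\preceq\beta$ (equivalently $\beta\succeq\alpha$) if $\sum_{i=1}^k\alpha_i\le\sum_{i=1}^k\beta_i$ for all $k=1,\dots,p$. For a 0-1 vector $\sigma$ of length $p$, $PM_\sigma$ is the $p\times p$ matrix with entry $0$ if $i+j\le p$, $\sigma_i$ if $i+j=p+1$, and $1$ if $i+j\ge p+2$. -}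

module Defs where

open import Data.Nat using (ℕ; zero; suc; _+_; _∸_; _≤_; _≡ᵇ_; _<ᵇ_)
open import Data.Bool using (Bool; true; false; not; if_then_else_)
open import Data.Fin using (Fin; toℕ; opposite) renaming (zero to fzero; suc to fsuc)
open import Data.Product using (∃; _×_)
open import Relation.Binary.PropositionalEquality using (_≡_)

-- Vectors of length p are functions Fin p → A; index i : Fin p corresponds
-- to the paper's 1-based index toℕ i + 1.

b2n : Bool → ℕ
b2n true  = 1
b2n false = 0

sumFin : (p : ℕ) → (Fin p → ℕ) → ℕ
sumFin zero    f = 0
sumFin (suc p) f = f fzero + sumFin p (λ i → f (fsuc i))

-- sum of the first k entries of a vector (k ≤ p; for k ≥ p it is the total)
prefixSum : (p : ℕ) → (Fin p → ℕ) → ℕ → ℕ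
prefixSum zero    f k       = 0
prefixSum (suc p) f zero    = 0
prefixSum (suc p) f (suc k) = f fzero + prefixSum p (λ i → f (fsuc i)) k

BVec : ℕ → Set
BVec p = Fin p → Bool

BMat : ℕ → Set
BMat p = Fin p → Fin p → Bool

compl : ∀ {p} → BVec p → BVec p
compl α i = not (α i)

rev : ∀ {p} → BVec p → BVec p
rev α i = α (opposite i)

_⪯_ : ∀ {p} → BVec p → BVec p → Set
_⪯_ {p} α β = ∀ (k : ℕ) → 1 ≤ k → k ≤ p →
  prefixSum p (λ i → b2n (α i)) k ≤ prefixSum p (λ i → b2n (β i)) k

ones : ∀ {p} → BVec p → ℕ
ones {p} α = sumFin p (λ i → b2n (α i))

rowSum : ∀ {p} → BMat p → Fin p → ℕ
rowSum M i = ones (λ j → M i j)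

colSum : ∀ {p} → BMat p → Fin p → ℕ
colSum M j = ones (λ i → M i j)

IsRealization : ∀ {p} → (Fin p → ℕ) → (Fin p → ℕ) → BMat p → Set
IsRealization x y M = (∀ i → rowSum M i ≡ x i) × (∀ j → colSum M j ≡ y j)

Consistent : ∀ {p} → (Fin p → ℕ) → (Fin p → ℕ) → Set
Consistent {p} x y = ∃ λ (M : BMat p) → IsRealization x y M

-- PM_σ with 1-based indices I = toℕ i + 1, J = toℕ j + 1:
-- 0 if I+J ≤ p, σ_I if I+J = p+1, 1 if I+J ≥ p+2.
PM : ∀ {p} → BVec p → BMat p
PM {p} σ i j =
  if (suc (toℕ i) + suc (toℕ j)) <ᵇ suc p then false
  else if (suc (toℕ i) + suc (toℕ j)) ≡ᵇ suc p then σ i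
  else true

shiftVec : ∀ {p} → BVec p → Fin p → ℕ
shiftVec α i = suc (toℕ i) ∸ b2n (α i)

{-# OPTIONS --safe #-}
-- Rotating a matrix a quarter turn (rotate M i j = M (opposite j) i) turns realizations of x, y
-- into matrices with i − βᵢ ones in row i and p + 1 − j − (rev α)ⱼ ones in column j (1-based).
-- Counting the ones of the first k rows against those of the first k columns, which have at most
-- p − k ones each below row k, gives Σ_{i≤k} βᵢ ≤ Σ_{i≤k} (rev α)ᵢ, with equality at k = p.
-- Conversely a realization is built by induction on p, choosing the first row and column. When
-- β = rev α these are forced, so the realization is unique: the lower triangular matrix with
-- diagonal ᾱ reversed, which is PM_ᾱ rotated.
module Submission where

open import Defs
open import Data.Bool using (Bool; true; false; not; _∧_; _∨_; if_then_else_)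
open import Data.Bool.Properties using (∨-identityʳ)
open import Data.Empty using (⊥-elim)
open import Data.Fin using (Fin; toℕ; opposite) renaming (zero to fzero; suc to fsuc)
open import Data.Fin.Permutation using (reverse)
open import Data.Fin.Properties using (opposite-prop; opposite-involutive; toℕ<n)
open import Data.Nat
  using (ℕ; zero; suc; _+_; _*_; _∸_; _≤_; _<_; _<ᵇ_; _≡ᵇ_; z≤n; s≤s; s≤s⁻¹)
open import Data.Nat.Properties
open import Data.Nat.Tactic.RingSolver using (solve-∀)
open import Data.Product using (∃; _×_; _,_; proj₁; proj₂)
open import Data.Vec.Functional using (_∷_; tail)
open import Data.Vec.Functional.Properties using (∷-cong)
open import Function using (_∘_)
open import Function.Bundles using (_⇔_; mk⇔; Equivalence)
open import Relation.Binary.PropositionalEquality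

open import Algebra.Properties.CommutativeMonoid.Sum +-0-commutativeMonoid using (sum; sum-permute)
open import Algebra.Properties.CommutativeSemigroup +-commutativeSemigroup using (interchange)
open Equivalence using (to; from)

private
  variable
    m n k c : ℕ
    f g : Fin n → ℕ
    a a′ d d′ : BVec n
    L M M′ : BMat n

sumFin-cong : f ≗ g → sumFin n f ≡ sumFin n g
sumFin-cong {n = zero}  _   = refl
sumFin-cong {n = suc n} f≗g = cong₂ _+_ (f≗g fzero) (sumFin-cong (f≗g ∘ fsuc))

prefixSum-cong : f ≗ g → prefixSum n f k ≡ prefixSum n g k
prefixSum-cong {n = zero}                _   = refl
prefixSum-cong {n = suc n} {k = zero}    _   = refl
prefixSum-cong {n = suc n} {k = suc k} f≗g = cong₂ _+_ (f≗g fzero) (prefixSum-cong (f≗g ∘ fsuc))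

sumFin-zero : sumFin n (λ _ → 0) ≡ 0
sumFin-zero {zero}  = refl
sumFin-zero {suc n} = sumFin-zero {n}

sumFin-+ : sumFin n (λ i → f i + g i) ≡ sumFin n f + sumFin n g
sumFin-+ {n = zero}          = refl
sumFin-+ {n = suc n} {f} {g} =
  trans (cong (f fzero + g fzero +_) (sumFin-+ {f = f ∘ fsuc} {g = g ∘ fsuc}))
        (interchange (f fzero) (g fzero) _ _)

prefixSum-+ : prefixSum n (λ i → f i + g i) k ≡ prefixSum n f k + prefixSum n g k
prefixSum-+ {n = zero}                  = refl
prefixSum-+ {n = suc n} {k = zero}      = refl
prefixSum-+ {n = suc n} {f} {g} {suc k} =
  trans (cong (f fzero + g fzero +_) (prefixSum-+ {f = f ∘ fsuc} {g = g ∘ fsuc}))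
        (interchange (f fzero) (g fzero) _ _)

sumFin-comm : (F : Fin m → Fin n → ℕ) →
  sumFin m (λ i → sumFin n (F i)) ≡ sumFin n (λ j → sumFin m (λ i → F i j))
sumFin-comm {zero}  {n} F = sym (sumFin-zero {n})
sumFin-comm {suc m} {n} F =
  trans (cong (sumFin n (F fzero) +_) (sumFin-comm (F ∘ fsuc))) (sym (sumFin-+ {f = F fzero}))

prefixSum-sumFin-comm : (F : Fin m → Fin n → ℕ) →
  prefixSum m (λ i → sumFin n (F i)) k ≡ sumFin n (λ j → prefixSum m (λ i → F i j) k)
prefixSum-sumFin-comm {zero}  {n}              F = sym (sumFin-zero {n})
prefixSum-sumFin-comm {suc m} {n} {k = zero}  F = sym (sumFin-zero {n})
prefixSum-sumFin-comm {suc m} {n} {k = suc k} F =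
  trans (cong (sumFin n (F fzero) +_) (prefixSum-sumFin-comm (F ∘ fsuc))) (sym (sumFin-+ {f = F fzero}))

sumFin≡sum : sumFin n f ≡ sum f
sumFin≡sum {n = zero}      = refl
sumFin≡sum {n = suc n} {f} = cong (f fzero +_) (sumFin≡sum {f = f ∘ fsuc})

sumFin-opposite : sumFin n (f ∘ opposite) ≡ sumFin n f
sumFin-opposite {f = f} =
  trans (sumFin≡sum {f = f ∘ opposite}) (trans (sym (sum-permute f reverse)) (sym (sumFin≡sum {f = f})))

prefixSum-const : k ≤ n → prefixSum n (λ _ → c) k ≡ k * c
prefixSum-const {k = zero}  {zero}  _         = refl
prefixSum-const {k = zero}  {suc n} _         = refl
prefixSum-const {k = suc k} {suc n} (s≤s k≤n) = cong (_ +_) (prefixSum-const k≤n)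

prefixSum-all : (f : Fin n → ℕ) → prefixSum n f n ≡ sumFin n f
prefixSum-all {zero}  f = refl
prefixSum-all {suc n} f = cong (f fzero +_) (prefixSum-all (f ∘ fsuc))

prefixSum-≤-sumFin : prefixSum n f k ≤ sumFin n f
prefixSum-≤-sumFin {zero}                      = z≤n
prefixSum-≤-sumFin {suc n} {k = zero}          = z≤n
prefixSum-≤-sumFin {suc n} {f = f} {k = suc k} =
  +-monoʳ-≤ (f fzero) (prefixSum-≤-sumFin {f = f ∘ fsuc})

prefixSum-mono : (∀ i → f i ≤ g i) → prefixSum n f k ≤ prefixSum n g k
prefixSum-mono {n = zero}                _   = z≤n
prefixSum-mono {n = suc n} {k = zero}    _   = z≤n
prefixSum-mono {n = suc n} {k = suc k} f≤g = +-mono-≤ (f≤g fzero) (prefixSum-mono (f≤g ∘ fsuc))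

prefixSum-suc : k ≤ n → prefixSum n (λ i → suc (f i)) k ≡ prefixSum n f k + k
prefixSum-suc {zero}  {zero}          _         = refl
prefixSum-suc {zero}  {suc n}         _         = refl
prefixSum-suc {suc k} {suc n} {f = f} (s≤s k≤n) = begin
  suc (f fzero + prefixSum n (λ i → suc (f (fsuc i))) k)
    ≡⟨ cong (suc ∘ (f fzero +_)) (prefixSum-suc k≤n) ⟩
  suc (f fzero + (prefixSum n (f ∘ fsuc) k + k))
    ≡⟨ rearrange (f fzero) _ k ⟩
  f fzero + prefixSum n (f ∘ fsuc) k + suc k
    ∎
  where
  open ≡-Reasoning
  rearrange : ∀ x y z → suc (x + (y + z)) ≡ x + y + suc z
  rearrange = solve-∀

triangular : k ≤ n → 2 * prefixSum n toℕ k + k ≡ k * k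
triangular {zero}  {zero}  _         = refl
triangular {zero}  {suc n} _         = refl
triangular {suc k} {suc n} (s≤s k≤n) = begin
  2 * prefixSum n (λ i → suc (toℕ i)) k + suc k ≡⟨ cong (λ t → 2 * t + suc k) (prefixSum-suc k≤n) ⟩
  2 * (T + k) + suc k                             ≡⟨ expand T k ⟩
  suc (2 * T + k + 2 * k)                         ≡⟨ cong (λ t → suc (t + 2 * k)) (triangular k≤n) ⟩
  suc (k * k + 2 * k)                             ≡⟨ square k ⟩
  suc k * suc k                                   ∎
  where
  open ≡-Reasoning
  T = prefixSum n toℕ k
  expand : ∀ t k → 2 * (t + k) + suc k ≡ suc (2 * t + k + 2 * k)
  expand = solve-∀
  square : ∀ k → suc (k * k + 2 * k) ≡ suc k * suc k
  square = solve-∀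

b2n-≤-1 : ∀ b → b2n b ≤ 1
b2n-≤-1 true  = s≤s z≤n
b2n-≤-1 false = z≤n

b2n-injective : ∀ {x y} → b2n x ≡ b2n y → x ≡ y
b2n-injective {true}  {true}  _ = refl
b2n-injective {false} {false} _ = refl

b2n-not-+ : ∀ b x → b2n (not b) + x + b2n b ≡ suc x
b2n-not-+ true  x = +-comm x 1
b2n-not-+ false x = cong suc (+-identityʳ x)

ones-true : ones {n} (λ _ → true) ≡ n
ones-true {zero}  = refl
ones-true {suc n} = cong suc ones-true

ones-≤ : (v : BVec n) → ones v ≤ n
ones-≤ {zero}  v = z≤n
ones-≤ {suc n} v = +-mono-≤ (b2n-≤-1 (v fzero)) (ones-≤ (tail v))

prefixSum-b2n-≤ : (v : BVec n) → prefixSum n (b2n ∘ v) k ≤ k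
prefixSum-b2n-≤ {zero}              v = z≤n
prefixSum-b2n-≤ {suc n} {k = zero}  v = z≤n
prefixSum-b2n-≤ {suc n} {k = suc k} v = +-mono-≤ (b2n-≤-1 (v fzero)) (prefixSum-b2n-≤ (tail v))

ones-≤-prefixSum+∸ : (v : BVec n) → ones v ≤ prefixSum n (b2n ∘ v) k + (n ∸ k)
ones-≤-prefixSum+∸ {zero}              v = z≤n
ones-≤-prefixSum+∸ {suc n} {k = zero}  v = ones-≤ v
ones-≤-prefixSum+∸ {suc n} {k = suc k} v =
  ≤-trans (+-monoʳ-≤ (b2n (v fzero)) (ones-≤-prefixSum+∸ (tail v)))
          (≤-reflexive (sym (+-assoc (b2n (v fzero)) _ _)))

ones≡0⇒≗false : (v : BVec n) → ones v ≡ 0 → ∀ i → v i ≡ false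
ones≡0⇒≗false v none fzero    = b2n-injective (m+n≡0⇒m≡0 (b2n (v fzero)) none)
ones≡0⇒≗false v none (fsuc i) = ones≡0⇒≗false (tail v) (m+n≡0⇒n≡0 (b2n (v fzero)) none) i

ones≡n⇒≗true : (v : BVec n) → ones v ≡ n → ∀ i → v i ≡ true
ones≡n⇒≗true {suc n} v all i with v fzero in v₀
ones≡n⇒≗true {suc n} v all fzero    | true  = v₀
ones≡n⇒≗true {suc n} v all (fsuc i) | true  = ones≡n⇒≗true (tail v) (suc-injective all) i
ones≡n⇒≗true {suc n} v all i        | false =
  ⊥-elim (1+n≰n (subst (_≤ n) all (ones-≤ (tail v))))

firstZero : BVec n → BVec n
firstZero {suc n} d fzero    = not (d fzero)
firstZero {suc n} d (fsuc j) = d fzero ∧ firstZero (tail d) j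

fillFirstZero : BVec n → BVec n
fillFirstZero d j = d j ∨ firstZero d j

b2n-fillFirstZero : (d : BVec n) → ∀ j → b2n (d j) + b2n (firstZero d j) ≡ b2n (fillFirstZero d j)
b2n-fillFirstZero {suc n} d fzero with d fzero
... | true  = refl
... | false = refl
b2n-fillFirstZero {suc n} d (fsuc j) with d fzero
... | true  = b2n-fillFirstZero (tail d) j
... | false with d (fsuc j)
...   | true  = refl
...   | false = refl

ones-firstZero : (d : BVec n) → ones d < n → ones (firstZero d) ≡ 1
ones-firstZero {suc n} d fewer with d fzero
... | true  = ones-firstZero (tail d) (s≤s⁻¹ fewer)
... | false = cong suc (sumFin-zero {n})

ones-fillFirstZero : (d : BVec n) → ones d < n → ones (fillFirstZero d) ≡ suc (ones d)
ones-fillFirstZero d fewer = begin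
  ones (fillFirstZero d)                           ≡⟨ sumFin-cong (sym ∘ b2n-fillFirstZero d) ⟩
  sumFin _ (λ j → b2n (d j) + b2n (firstZero d j)) ≡⟨ sumFin-+ {f = b2n ∘ d} ⟩
  ones d + ones (firstZero d)                      ≡⟨ cong (ones d +_) (ones-firstZero d fewer) ⟩
  ones d + 1                                       ≡⟨ +-comm (ones d) 1 ⟩
  suc (ones d)                                     ∎
  where open ≡-Reasoning

≤-prefixSum-fillFirstZero : (d : BVec n) → k ≤ n →
  ∀ {x} → x ≤ k → x ≤ suc (prefixSum n (b2n ∘ d) k) → x ≤ prefixSum n (b2n ∘ fillFirstZero d) k
≤-prefixSum-fillFirstZero {k = zero} d _ z≤n _ = z≤n
≤-prefixSum-fillFirstZero {suc n} {suc k} d (s≤s k≤n) {x} x≤k x≤ with d fzero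
... | false = subst (x ≤_) (cong suc (prefixSum-cong (cong b2n ∘ sym ∘ ∨-identityʳ ∘ d ∘ fsuc))) x≤
≤-prefixSum-fillFirstZero {suc n} {suc k} d (s≤s k≤n) {zero} x≤k x≤ | true = z≤n
≤-prefixSum-fillFirstZero {suc n} {suc k} d (s≤s k≤n) {suc x} (s≤s x≤k) (s≤s x≤) | true =
  s≤s (≤-prefixSum-fillFirstZero (tail d) k≤n x≤k x≤)

-- Row i has i + 1 − aᵢ ones and column j has n − j − dⱼ ones (0-based i, j), written without
-- truncated subtraction; see rotate-realization.
IsRotatedRealization : BVec n → BVec n → BMat n → Set
IsRotatedRealization {n} a d L =
  (∀ i → rowSum L i + b2n (a i) ≡ suc (toℕ i)) × (∀ j → colSum L j + b2n (d j) + toℕ j ≡ n)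

IsRotatedRealization-cong : a ≗ a′ → d ≗ d′ →
  IsRotatedRealization a d L → IsRotatedRealization a′ d′ L
IsRotatedRealization-cong {L = L} a≗a′ d≗d′ (rows , cols) =
  (λ i → trans (cong (λ b → rowSum L i + b2n b) (sym (a≗a′ i))) (rows i)) ,
  (λ j → trans (cong (λ b → colSum L j + b2n b + toℕ j) (sym (d≗d′ j))) (cols j))

IsRotatedRealization-entrywise : (∀ i j → L i j ≡ M i j) →
  IsRotatedRealization a d L → IsRotatedRealization a d M
IsRotatedRealization-entrywise {a = a} {d} L≗M (rows , cols) =
  (λ i → trans (cong (_+ b2n (a i)) (sumFin-cong (cong b2n ∘ sym ∘ L≗M i))) (rows i)) ,
  (λ j → trans (cong (λ s → s + b2n (d j) + toℕ j) (sumFin-cong (λ i → cong b2n (sym (L≗M i j)))))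
               (cols j))

prefixSum-colSum-≤ : (L : BMat n) → k ≤ n →
  prefixSum n (colSum L) k ≤ prefixSum n (rowSum L) k + k * (n ∸ k)
prefixSum-colSum-≤ {n} {k} L k≤n = begin
  prefixSum n (colSum L) k
    ≤⟨ prefixSum-mono (λ j → ones-≤-prefixSum+∸ (λ i → L i j)) ⟩
  prefixSum n (λ j → upper j + (n ∸ k)) k
    ≡⟨ prefixSum-+ {f = upper} ⟩
  prefixSum n upper k + prefixSum n (λ _ → n ∸ k) k
    ≡⟨ cong (prefixSum n upper k +_) (prefixSum-const k≤n) ⟩
  prefixSum n upper k + k * (n ∸ k)
    ≤⟨ +-monoˡ-≤ (k * (n ∸ k)) (prefixSum-≤-sumFin {f = upper}) ⟩
  sumFin n upper + k * (n ∸ k)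
    ≡⟨ cong (_+ k * (n ∸ k)) (prefixSum-sumFin-comm (λ i j → b2n (L i j))) ⟨
  prefixSum n (rowSum L) k + k * (n ∸ k)
    ∎
  where
  open ≤-Reasoning
  upper : Fin n → ℕ
  upper j = prefixSum n (λ i → b2n (L i j)) k

-- The first k rows hold Σ_{i<k} (i + 1 − aᵢ) ones, the first k columns Σ_{j<k} (n − j − dⱼ);
-- the k * k is Σ_{i<k} (2 i + 1).
prefixSum-balance : IsRotatedRealization a d L → k ≤ n →
  prefixSum n (colSum L) k + prefixSum n (b2n ∘ d) k + k * k
    ≡ prefixSum n (rowSum L) k + prefixSum n (b2n ∘ a) k + k * n
prefixSum-balance {n} {a} {d} {L} {k} (rows , cols) k≤n = begin
  C + D + k * k             ≡⟨ cong (C + D +_) (triangular k≤n) ⟨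
  C + D + (2 * T + k)       ≡⟨ regroup C D T k ⟩
  (C + D + T) + (T + k)     ≡⟨ cong₂ _+_ colSums rowSums ⟩
  k * n + (R + A)           ≡⟨ +-comm (k * n) (R + A) ⟩
  R + A + k * n             ∎
  where
  open ≡-Reasoning
  C = prefixSum n (colSum L) k
  D = prefixSum n (b2n ∘ d) k
  R = prefixSum n (rowSum L) k
  A = prefixSum n (b2n ∘ a) k
  T = prefixSum n toℕ k
  regroup : ∀ c d t k → c + d + (2 * t + k) ≡ c + d + t + (t + k)
  regroup = solve-∀
  rowSums : T + k ≡ R + A
  rowSums = sym (trans (sym (prefixSum-+ {f = rowSum L})) (trans (prefixSum-cong rows) (prefixSum-suc k≤n)))
  colSums : C + D + T ≡ k * n
  colSums = begin
    C + D + T                                            ≡⟨ cong (_+ T) (prefixSum-+ {f = colSum L}) ⟨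
    prefixSum n colD k + T                               ≡⟨ prefixSum-+ {f = colD} ⟨
    prefixSum n (λ j → colSum L j + b2n (d j) + toℕ j) k ≡⟨ prefixSum-cong cols ⟩
    prefixSum n (λ _ → n) k                              ≡⟨ prefixSum-const k≤n ⟩
    k * n                                                ∎
    where
    colD : Fin n → ℕ
    colD j = colSum L j + b2n (d j)

realization-ones≡ : IsRotatedRealization a d L → ones a ≡ ones d
realization-ones≡ {n} {a} {d} {L} r = begin
  ones a                      ≡⟨ prefixSum-all (b2n ∘ a) ⟨
  prefixSum n (b2n ∘ a) n     ≡⟨ +-cancelˡ-≡ S _ _ (+-cancelʳ-≡ (n * n) _ _ balance) ⟩
  prefixSum n (b2n ∘ d) n     ≡⟨ prefixSum-all (b2n ∘ d) ⟩
  ones d                      ∎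
  where
  open ≡-Reasoning
  S = prefixSum n (rowSum L) n
  rowSums≡colSums : S ≡ prefixSum n (colSum L) n
  rowSums≡colSums = begin
    S                              ≡⟨ prefixSum-all (rowSum L) ⟩
    sumFin n (rowSum L)            ≡⟨ sumFin-comm (λ i j → b2n (L i j)) ⟩
    sumFin n (colSum L)            ≡⟨ prefixSum-all (colSum L) ⟨
    prefixSum n (colSum L) n       ∎
  balance : S + prefixSum n (b2n ∘ a) n + n * n ≡ S + prefixSum n (b2n ∘ d) n + n * n
  balance = sym (trans (cong (λ s → s + prefixSum n (b2n ∘ d) n + n * n) rowSums≡colSums)
                       (prefixSum-balance r ≤-refl))

realization-prefixSum≤ : IsRotatedRealization a d L → k ≤ n →
  prefixSum n (b2n ∘ a) k ≤ prefixSum n (b2n ∘ d) k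
realization-prefixSum≤ {n} {a} {d} {L} {k} r k≤n = +-cancelˡ-≤ R _ _ (+-cancelʳ-≤ (k * n) _ _ (begin
  R + A + k * n                 ≡⟨ prefixSum-balance r k≤n ⟨
  C + D + k * k                 ≤⟨ +-monoˡ-≤ (k * k) (+-monoˡ-≤ D (prefixSum-colSum-≤ L k≤n)) ⟩
  R + k * (n ∸ k) + D + k * k   ≡⟨ regroup R (k * (n ∸ k)) D (k * k) ⟩
  R + D + (k * k + k * (n ∸ k)) ≡⟨ cong (R + D +_) square+rectangle ⟩
  R + D + k * n                 ∎))
  where
  open ≤-Reasoning
  C = prefixSum n (colSum L) k
  D = prefixSum n (b2n ∘ d) k
  R = prefixSum n (rowSum L) k
  A = prefixSum n (b2n ∘ a) k
  regroup : ∀ r s d q → r + s + d + q ≡ r + d + (q + s)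
  regroup = solve-∀
  square+rectangle : k * k + k * (n ∸ k) ≡ k * n
  square+rectangle = trans (sym (*-distribˡ-+ k k (n ∸ k))) (cong (k *_) (m+[n∸m]≡n k≤n))

realization-necessary : IsRotatedRealization a d L → ones a ≡ ones d × a ⪯ d
realization-necessary r = realization-ones≡ r , λ _ _ → realization-prefixSum≤ r

border : Bool → BVec m → BMat m → BMat (suc m)
border c r N = (c ∷ r) ∷ λ i → true ∷ N i

border-realization : ∀ {a₀ d₀} {r : BVec m} {N : BMat m} →
  IsRotatedRealization a d′ N →
  b2n (not d₀) + ones r + b2n a₀ ≡ 1 →
  (∀ j → b2n (d j) + b2n (r j) ≡ b2n (d′ j)) →
  IsRotatedRealization (a₀ ∷ a) (d₀ ∷ d) (border (not d₀) r N)
border-realization {m} {a} {d′} {d} {a₀} {d₀} {r} {N} (rows , cols) row₀ r+d≡d′ =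
  rows′ , cols′
  where
  rows′ : ∀ i → rowSum (border (not d₀) r N) i + b2n ((a₀ ∷ a) i) ≡ suc (toℕ i)
  rows′ fzero    = row₀
  rows′ (fsuc i) = cong suc (rows i)
  cols′ : ∀ j → colSum (border (not d₀) r N) j + b2n ((d₀ ∷ d) j) + toℕ j ≡ suc m
  cols′ fzero    = trans (+-identityʳ _)
                     (trans (cong (λ s → b2n (not d₀) + s + b2n d₀) ones-true) (b2n-not-+ d₀ m))
  cols′ (fsuc j) = begin
    b2n (r j) + colSum N j + b2n (d j) + suc (toℕ j)
      ≡⟨ regroup (b2n (r j)) (colSum N j) (b2n (d j)) (toℕ j) ⟩
    suc (colSum N j + (b2n (d j) + b2n (r j)) + toℕ j)
      ≡⟨ cong (λ b → suc (colSum N j + b + toℕ j)) (r+d≡d′ j) ⟩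
    suc (colSum N j + b2n (d′ j) + toℕ j)
      ≡⟨ cong suc (cols j) ⟩
    suc m
      ∎
    where
    open ≡-Reasoning
    regroup : ∀ r c d j → r + c + d + suc j ≡ suc (c + (d + r) + j)
    regroup = solve-∀

realization-exists : ones a ≡ ones d → a ⪯ d → ∃ (IsRotatedRealization a d)

-- The corner entry is ¬ d₀ and the rest of the first column is all ones, so the rest of the first row
-- needs a one exactly when a₀ = 0 and d₀ = 1; it goes above the first zero of d, which becomes a one.
cons-realization-exists : ∀ a₀ d₀ {a d : BVec m} → b2n a₀ + ones a ≡ b2n d₀ + ones d →
  (∀ {k} → k ≤ m → b2n a₀ + prefixSum m (b2n ∘ a) k ≤ b2n d₀ + prefixSum m (b2n ∘ d) k) →
  ∃ (IsRotatedRealization (a₀ ∷ a) (d₀ ∷ d))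
cons-realization-exists true false {d = d} _ maj =
  ⊥-elim (n≮0 (≤-trans (maj z≤n) (prefixSum-b2n-≤ d)))
cons-realization-exists {m} true true tot maj =
  let N , r = realization-exists (suc-injective tot) (λ _ _ k≤m → s≤s⁻¹ (maj k≤m)) in
  border false (λ _ → false) N ,
  border-realization r (trans (b2n-not-+ true _) (cong suc (sumFin-zero {m}))) (λ _ → +-identityʳ _)
cons-realization-exists {m} false false tot maj =
  let N , r = realization-exists tot (λ _ _ → maj) in
  border true (λ _ → false) N ,
  border-realization r (trans (b2n-not-+ false _) (cong suc (sumFin-zero {m}))) (λ _ → +-identityʳ _)
cons-realization-exists {m} false true {a} {d} tot maj =
  let N , r = realization-exists (trans tot (sym (ones-fillFirstZero d fewer)))
                (λ _ _ k≤m → ≤-prefixSum-fillFirstZero d k≤m (prefixSum-b2n-≤ a) (maj k≤m)) in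
  border false (firstZero d) N ,
  border-realization r (trans (+-identityʳ _) (ones-firstZero d fewer)) (b2n-fillFirstZero d)
  where
  fewer : ones d < m
  fewer = subst (_≤ m) tot (ones-≤ a)

realization-exists {zero}          _   _   = (λ ()) , (λ ()) , (λ ())
realization-exists {suc m} {a} {d} tot maj =
  let L , r = cons-realization-exists (a fzero) (d fzero) tot (maj _ (s≤s z≤n) ∘ s≤s) in
  L , IsRotatedRealization-cong {L = L} (head∷tail a) (head∷tail d) r
  where
  head∷tail : (v : BVec (suc m)) → (v fzero ∷ tail v) ≗ v
  head∷tail v = ∷-cong refl (λ _ → refl)

lowerTri : BVec n → BMat n
lowerTri σ i j = if toℕ i <ᵇ toℕ j then false else if toℕ i ≡ᵇ toℕ j then σ j else true

lowerTri-realization : IsRotatedRealization a a (lowerTri (compl a))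
lowerTri-realization {a = a} = rows a , cols a
  where
  rows : (a : BVec n) → ∀ i → rowSum (lowerTri (compl a)) i + b2n (a i) ≡ suc (toℕ i)
  rows {suc n} a fzero    = trans (cong (λ s → b2n (not (a fzero)) + s + b2n (a fzero)) (sumFin-zero {n}))
                                  (b2n-not-+ (a fzero) 0)
  rows {suc n} a (fsuc i) = cong suc (rows (tail a) i)
  cols : (a : BVec n) → ∀ j → colSum (lowerTri (compl a)) j + b2n (a j) + toℕ j ≡ n
  cols {suc n} a fzero    = trans (+-identityʳ _)
                              (trans (cong (λ s → b2n (not (a fzero)) + s + b2n (a fzero)) ones-true)
                                     (b2n-not-+ (a fzero) n))
  cols {suc n} a (fsuc j) = trans (+-suc _ (toℕ j)) (cong suc (cols (tail a) j))

corner-forced : ∀ {x a₀} (u w : BVec m) →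
  b2n x + ones u + b2n a₀ ≡ 1 → b2n x + ones w + b2n a₀ ≡ suc m →
  x ≡ not a₀ × (∀ j → u j ≡ false) × (∀ i → w i ≡ true)
corner-forced {m} {false} {true} u w row col =
  refl , ones≡0⇒≗false u (+-cancelʳ-≡ 1 _ 0 row)
       , ones≡n⇒≗true w (+-cancelʳ-≡ 1 _ m (trans col (+-comm 1 m)))
corner-forced {m} {true} {false} u w row col =
  refl , ones≡0⇒≗false u (trans (sym (+-identityʳ _)) (suc-injective row))
       , ones≡n⇒≗true w (trans (sym (+-identityʳ _)) (suc-injective col))
corner-forced {m} {true} {true} u w row col with () ← m+n≡0⇒n≡0 (ones u) (suc-injective row)
corner-forced {m} {false} {false} u w row col =
  ⊥-elim (1+n≰n (subst (_≤ m) (trans (sym (+-identityʳ _)) col) (ones-≤ w)))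

peel-realization : IsRotatedRealization a d L →
  (∀ j → L fzero (fsuc j) ≡ false) → (∀ i → L (fsuc i) fzero ≡ true) →
  IsRotatedRealization (tail a) (tail d) (λ i j → L (fsuc i) (fsuc j))
peel-realization {a = a} {d} {L} (rows , cols) row₀ col₀ =
  (λ i → suc-injective (trans (cong (λ b → b2n b + rowSum N i + b2n (a (fsuc i))) (sym (col₀ i)))
                              (rows (fsuc i)))) ,
  (λ j → suc-injective (trans (sym (+-suc _ (toℕ j)))
           (trans (cong (λ b → b2n b + colSum N j + b2n (d (fsuc j)) + suc (toℕ j)) (sym (row₀ j)))
                  (cols (fsuc j)))))
  where
  N : BMat _
  N i j = L (fsuc i) (fsuc j)

lowerTri-unique : IsRotatedRealization a a L → ∀ i j → L i j ≡ lowerTri (compl a) i j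
lowerTri-unique {suc m} {a} {L} r@(rows , cols) = entries
  where
  corner = corner-forced (λ j → L fzero (fsuc j)) (λ i → L (fsuc i) fzero)
             (rows fzero) (trans (sym (+-identityʳ _)) (cols fzero))
  entries : ∀ i j → L i j ≡ lowerTri (compl a) i j
  entries fzero    fzero    = proj₁ corner
  entries fzero    (fsuc j) = proj₁ (proj₂ corner) j
  entries (fsuc i) fzero    = proj₂ (proj₂ corner) i
  entries (fsuc i) (fsuc j) =
    lowerTri-unique (peel-realization {L = L} r (proj₁ (proj₂ corner)) (proj₂ (proj₂ corner))) i j

rotate : BMat n → BMat n
rotate M i j = M (opposite j) i

unrotate : BMat n → BMat n
unrotate L i j = L j (opposite i)

rotate-unrotate : ∀ i j → rotate (unrotate L) i j ≡ L i j
rotate-unrotate {L = L} i j = cong (L i) (opposite-involutive j)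

rotate-injective : (∀ i j → rotate M i j ≡ rotate M′ i j) → ∀ i j → M i j ≡ M′ i j
rotate-injective {M = M} {M′} eq i j =
  subst (λ i′ → M i′ j ≡ M′ i′ j) (opposite-involutive i) (eq j (opposite i))

toℕ-opposite-+ : (i : Fin n) → toℕ (opposite i) + suc (toℕ i) ≡ n
toℕ-opposite-+ i = trans (cong (_+ suc (toℕ i)) (opposite-prop i)) (m∸n+n≡m (toℕ<n i))

m+b≡1+n⇒m≡1+n∸b : ∀ {x y} b → x + b2n b ≡ suc y → x ≡ suc y ∸ b2n b
m+b≡1+n⇒m≡1+n∸b {x} b eq = trans (sym (m+n∸n≡m x (b2n b))) (cong (_∸ b2n b) eq)

1+n∸b+b≡1+n : ∀ y b → suc y ∸ b2n b + b2n b ≡ suc y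
1+n∸b+b≡1+n y b = m∸n+n≡m (≤-trans (b2n-≤-1 b) (s≤s z≤n))

rotate-realization : (α β : BVec n) →
  IsRealization (shiftVec α) (shiftVec β) M ⇔ IsRotatedRealization β (rev α) (rotate M)
rotate-realization {n} {M} α β = mk⇔ to′ from′
  where
  rowSum-rotate : ∀ i → rowSum (rotate M) i ≡ colSum M i
  rowSum-rotate i = sumFin-opposite {f = λ j → b2n (M j i)}
  to′ : IsRealization (shiftVec α) (shiftVec β) M → IsRotatedRealization β (rev α) (rotate M)
  to′ (rows , cols) =
    (λ i → trans (cong (_+ b2n (β i)) (trans (rowSum-rotate i) (cols i))) (1+n∸b+b≡1+n (toℕ i) (β i))) ,
    (λ j → trans (cong (λ s → s + b2n (α (opposite j)) + toℕ j) (rows (opposite j)))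
             (trans (cong (_+ toℕ j) (1+n∸b+b≡1+n (toℕ (opposite j)) (α (opposite j))))
               (trans (sym (+-suc _ (toℕ j))) (toℕ-opposite-+ j))))
  from′ : IsRotatedRealization β (rev α) (rotate M) → IsRealization (shiftVec α) (shiftVec β) M
  from′ (rows , cols) =
    (λ i → m+b≡1+n⇒m≡1+n∸b (α i) (rows′ i)) ,
    (λ j → m+b≡1+n⇒m≡1+n∸b (β j) (trans (cong (_+ b2n (β j)) (sym (rowSum-rotate j))) (rows j)))
    where
    rows′ : ∀ i → rowSum M i + b2n (α i) ≡ suc (toℕ i)
    rows′ i = +-cancelʳ-≡ (toℕ (opposite i)) _ _ (begin
      rowSum M i + b2n (α i) + toℕ (opposite i)
        ≡⟨ subst (λ i′ → rowSum M i′ + b2n (α i′) + toℕ (opposite i) ≡ n) (opposite-involutive i)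
                 (cols (opposite i)) ⟩
      n ≡⟨ toℕ-opposite-+ i ⟨
      toℕ (opposite i) + suc (toℕ i) ≡⟨ +-comm (toℕ (opposite i)) _ ⟩
      suc (toℕ i) + toℕ (opposite i) ∎)
      where open ≡-Reasoning

+-<ᵇ-cancelˡ : ∀ o {x y} → (o + x <ᵇ o + y) ≡ (x <ᵇ y)
+-<ᵇ-cancelˡ zero    = refl
+-<ᵇ-cancelˡ (suc o) = +-<ᵇ-cancelˡ o

+-≡ᵇ-cancelˡ : ∀ o {x y} → (o + x ≡ᵇ o + y) ≡ (x ≡ᵇ y)
+-≡ᵇ-cancelˡ zero    = refl
+-≡ᵇ-cancelˡ (suc o) = +-≡ᵇ-cancelˡ o

rotate-PM : (σ : BVec n) → ∀ i j → rotate (PM σ) i j ≡ lowerTri (rev σ) i j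
rotate-PM {n} σ i j =
  cong₂ (λ below diagonal → if below then false else if diagonal then σ (opposite j) else true)
  (trans (cong (O + suc (toℕ i) <ᵇ_) (sym (toℕ-opposite-+ j))) (+-<ᵇ-cancelˡ O))
  (trans (cong (O + suc (toℕ i) ≡ᵇ_) (sym (toℕ-opposite-+ j))) (+-≡ᵇ-cancelˡ O))
  where
  O = toℕ (opposite j)

rowSums-determine : IsRotatedRealization a d L → IsRotatedRealization a′ d′ L → a ≗ a′
rowSums-determine {L = L} (rows , _) (rows′ , _) i =
  b2n-injective (+-cancelˡ-≡ (rowSum L i) _ _ (trans (rows i) (sym (rows′ i))))

PM-rotated-realization : (α : BVec n) → IsRotatedRealization (rev α) (rev α) (rotate (PM (compl α)))
PM-rotated-realization α =
  IsRotatedRealization-entrywise (λ i j → sym (rotate-PM (compl α) i j)) lowerTri-realization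

consistent⇒balanced : (α β : BVec n) →
  Consistent (shiftVec α) (shiftVec β) → ones (rev α) ≡ ones β × β ⪯ rev α
consistent⇒balanced α β (M , r) =
  let tot , maj = realization-necessary (to (rotate-realization α β) r) in sym tot , maj

balanced⇒consistent : (α β : BVec n) →
  ones (rev α) ≡ ones β × β ⪯ rev α → Consistent (shiftVec α) (shiftVec β)
balanced⇒consistent α β (tot , maj) =
  let L , r = realization-exists (sym tot) maj in
  unrotate L , from (rotate-realization α β)
                 (IsRotatedRealization-entrywise (λ i j → sym (rotate-unrotate {L = L} i j)) r)

PM-realization : (α β : BVec n) → rev α ≗ β → IsRealization (shiftVec α) (shiftVec β) (PM (compl α))
PM-realization α β rev≗ =
  from (rotate-realization α β) (IsRotatedRealization-cong rev≗ (λ _ → refl) (PM-rotated-realization α))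

PM-unique : (α β : BVec n) → rev α ≗ β →
  IsRealization (shiftVec α) (shiftVec β) M → ∀ i j → M i j ≡ PM (compl α) i j
PM-unique {M = M} α β rev≗ r = rotate-injective λ i j →
  trans (lowerTri-unique (IsRotatedRealization-cong {L = rotate M} (sym ∘ rev≗) (λ _ → refl)
                                                    (to (rotate-realization α β) r)) i j)
        (sym (rotate-PM (compl α) i j))

PM-realization⇒reversed : (α β : BVec n) →
  IsRealization (shiftVec α) (shiftVec β) (PM (compl α)) → rev α ≗ β
PM-realization⇒reversed α β r =
  rowSums-determine (PM-rotated-realization α) (to (rotate-realization α β) r)

-- Part (b) holds without the consistency hypothesis.
lemma5 : (p : ℕ) → (α β : BVec p) →
    (Consistent (shiftVec α) (shiftVec β) ⇔ ((ones (rev α) ≡ ones β) × (β ⪯ rev α)))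
    × (Consistent (shiftVec α) (shiftVec β) →
        ((∀ i → rev α i ≡ β i) ⇔
          (IsRealization (shiftVec α) (shiftVec β) (PM (compl α))
            × (∀ (M : BMat p) → IsRealization (shiftVec α) (shiftVec β) M →
                 ∀ i j → M i j ≡ PM (compl α) i j))))
lemma5 p α β =
  mk⇔ (consistent⇒balanced α β) (balanced⇒consistent α β) ,
  λ _ → mk⇔ (λ rev≗ → PM-realization α β rev≗ , λ M → PM-unique α β rev≗)
            (PM-realization⇒reversed α β ∘ proj₁)
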